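{- Let $N\ge1$ be an integer and $\gamma=\begin{pmatrix}a&b\\c&d\end{pmatrix}\in SL(2,\mathbb Z)$. Set $M=\gcd(N,2cd)$. Then the subgroup of $SL(2,\mathbb Z)$ generated by $\Gamma_0(N)$ and the set $\left\{\begin{pmatrix}a'&b'\\c'&d'\end{pmatrix}\gamma^{ -1}\;:\;\begin{pmatrix}a'&b'\\c'&d'\end{pmatrix}\in SL(2,\mathbb Z),\ d'\equiv d\pmod N,\ c'\equiv mc\pmod N\text{ for some }m\in(\mathbb Z/N\mathbb Z)^\times\right\}$ is $\Gamma_0(M)$.
   Context: $\Gamma_0(k)$ is the subgroup of $SL(2,\mathbb Z)$ of matrices with lower-left entry divisible by $k$. -}

module Defs where

open import Data.Nat as ℕ using (ℕ)
open import Data.Nat.GCD using (gcd)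
open import Data.Nat.Coprimality using (Coprime)
open import Data.Integer using (ℤ; +_; _+_; _-_; _*_; -_; ∣_∣)
open import Data.Integer.Divisibility using (_∣_)
open import Data.Product using (Σ; ∃; _×_)
open import Data.Sum using (_⊎_)
open import Relation.Binary.PropositionalEquality using (_≡_)

record Mat : Set where
  constructor mat
  field
    a b c d : ℤ
open Mat public

det : Mat → ℤ
det m = a m * d m - b m * c m

IsSL : Mat → Set
IsSL m = det m ≡ + 1

_·_ : Mat → Mat → Mat
mat a₁ b₁ c₁ d₁ · mat a₂ b₂ c₂ d₂ =
  mat (a₁ * a₂ + b₁ * c₂) (a₁ * b₂ + b₁ * d₂)
      (c₁ * a₂ + d₁ * c₂) (c₁ * b₂ + d₁ * d₂)

I₂ : Mat
I₂ = mat (+ 1) (+ 0) (+ 0) (+ 1)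

-- inverse of an SL(2,ℤ) matrix (adjugate)
inv : Mat → Mat
inv (mat a b c d) = mat d (- b) (- c) a

_≡_[mod_] : ℤ → ℤ → ℕ → Set
x ≡ y [mod n ] = (+ n) ∣ (x - y)

Γ₀ : ℕ → Mat → Set
Γ₀ k m = IsSL m × ((+ k) ∣ c m)

data ⟨_⟩ (S : Mat → Set) : Mat → Set where
  gen  : ∀ {x} → S x → ⟨ S ⟩ x
  one  : ⟨ S ⟩ I₂
  mul  : ∀ {x y} → ⟨ S ⟩ x → ⟨ S ⟩ y → ⟨ S ⟩ (x · y)
  ginv : ∀ {x} → ⟨ S ⟩ x → ⟨ S ⟩ (inv x)

T : ℕ → Mat → Mat → Set
T N γ x = Σ Mat λ γ' → IsSL γ'
  × d γ' ≡ d γ [mod N ]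
  × (Σ ℤ λ m → Coprime ∣ m ∣ N × c γ' ≡ m * c γ [mod N ])
  × x ≡ γ' · inv γ

Gens : ℕ → Mat → Mat → Set
Gens N γ x = Γ₀ N x ⊎ T N γ x

level : ℕ → Mat → ℕ
level N γ = gcd N ∣ + 2 * c γ * d γ ∣

-- Γ₀(M) is a subgroup containing the generators: the lower-left entry c′d − d′c of γ′γ⁻¹ is
-- ≡ (m − 1)cd modulo N, and M ∣ (m − 1)cd because M ∣ 2cd and, when m is even, N and hence
-- M are odd.
-- Conversely, a subgroup H ⊇ Γ₀(N) contains y as soon as y h⁻¹ ∈ Γ₀(N) for some h ∈ H, i.e.
-- as soon as c_y d_h ≡ d_y c_h (mod N). The generator with m = −1, γ′ = (a, −b; −c, d), is
-- an h ∈ H with c_h = −2cd. Comparing L t = (1, 0; t, 1) with h U β, U β = (1, β; 0, 1),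
-- where β makes d_h + β c_h a unit mod N, puts L t into H for all t in the ideal
-- (c_h, N) = (M). Finally y ∈ Γ₀(M) is compared with L (c_y u) · U (−j), where d_y + j c_y
-- is a unit mod N with inverse u.
module Submission where

open import Defs
open import Data.Nat using (ℕ; _≤_)
open import Function.Bundles using (_⇔_; mk⇔)
open import Function.Base using (_∘_)
open import Data.Nat as ℕ using (zero; suc; NonZero)
import Data.Nat.Properties as ℕ
import Data.Nat.Divisibility as ℕ
open import Data.Nat.Induction using (<-rec)
open import Data.Nat.GCD using (gcd; gcd[m,n]∣m; gcd[m,n]∣n; gcd-GCD; module Bézout)
open import Data.Nat.Coprimality using (Coprime; 1-coprimeTo)
open import Data.Integer using (ℤ; +_; -[1+_]; -1ℤ; _+_; _-_; _*_; -_; ∣_∣)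
import Data.Integer.Properties as ℤ
open import Data.Integer.Divisibility.Signed
  using (_∣_; divides; ∣ᵤ⇒∣; ∣⇒∣ᵤ; ∣-refl; ∣n⇒∣m*n; ∣m⇒∣m*n; ∣m∣n⇒∣m+n; ∣m∣n⇒∣m-n)
open import Data.Integer.DivMod using (_/ℕ_; _%ℕ_; n%ℕd<d; a≡a%ℕn+[a/ℕn]*n)
import Data.Integer.Coprimality as ℤ
open import Data.Integer.Tactic.RingSolver using (solve; solve-∀)
open import Data.List using ([]; _∷_)
open import Data.Product using (∃-syntax; ∃₂; _,_)
open import Data.Sum using (_⊎_; inj₁; inj₂)
open import Data.Empty using (⊥-elim)
open import Relation.Binary.PropositionalEquality

BézoutCoprime : ℤ → ℤ → Set
BézoutCoprime X Y = ∃₂ λ u v → u * X + v * Y ≡ + 1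

BézoutCoprime-*ʳ : ∀ {X Y Z} → BézoutCoprime X Y → BézoutCoprime X Z → BézoutCoprime X (Y * Z)
BézoutCoprime-*ʳ {X} {Y} {Z} (u₁ , v₁ , e₁) (u₂ , v₂ , e₂) =
  u₁ * u₂ * X + u₁ * v₂ * Z + v₁ * Y * u₂ , v₁ * v₂ , (begin
    (u₁ * u₂ * X + u₁ * v₂ * Z + v₁ * Y * u₂) * X + v₁ * v₂ * (Y * Z)
      ≡⟨ solve (u₁ ∷ v₁ ∷ u₂ ∷ v₂ ∷ X ∷ Y ∷ Z ∷ []) ⟩
    (u₁ * X + v₁ * Y) * (u₂ * X + v₂ * Z)
      ≡⟨ cong₂ _*_ e₁ e₂ ⟩
    + 1 ∎)
  where open ≡-Reasoning

BézoutCoprime-∣ʳ : ∀ {X Y Z} → BézoutCoprime X Y → Z ∣ Y → BézoutCoprime X Z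
BézoutCoprime-∣ʳ {X} {Y} {Z} (u , v , e) (divides w refl) =
  u , v * w , trans (cong (_+_ (u * X)) (ℤ.*-assoc v w Z)) e

BézoutCoprime-+*ˡ : ∀ {D E} j → BézoutCoprime D E → BézoutCoprime (D + j * E) E
BézoutCoprime-+*ˡ {D} {E} j (p , q , pD+qE≡1) = p , q - p * j , (begin
  p * (D + j * E) + (q - p * j) * E ≡⟨ solve (p ∷ q ∷ D ∷ j ∷ E ∷ []) ⟩
  p * D + q * E                     ≡⟨ pD+qE≡1 ⟩
  + 1                               ∎)
  where open ≡-Reasoning

i+j≡k⇒i≡k-j : ∀ {i j k : ℤ} → i + j ≡ k → i ≡ k - j
i+j≡k⇒i≡k-j {i} {j} {k} i+j≡k = begin
  i         ≡⟨ solve (i ∷ j ∷ []) ⟩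
  i + j - j ≡⟨ cong (_- j) i+j≡k ⟩
  k - j     ∎
  where open ≡-Reasoning

pos-+*≡* : ∀ {a} b c d e → a ℕ.+ b ℕ.* c ≡ d ℕ.* e → + a + + b * + c ≡ + d * + e
pos-+*≡* {a} b c d e eq = begin
  + a + + b * + c   ≡⟨ cong (_+_ (+ a)) (ℤ.pos-* b c) ⟨
  + a + + (b ℕ.* c) ≡⟨ ℤ.pos-+ a (b ℕ.* c) ⟨
  + (a ℕ.+ b ℕ.* c) ≡⟨ cong +_ eq ⟩
  + (d ℕ.* e)       ≡⟨ ℤ.pos-* d e ⟩
  + d * + e         ∎
  where open ≡-Reasoning

gcd-Bézoutℕ : ∀ n A → ∃₂ λ P W → + gcd n A ≡ P * + A + W * + n
gcd-Bézoutℕ n A with Bézout.identity (gcd-GCD n A)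
... | Bézout.+- x y eq =
  - + y , + x , trans (i+j≡k⇒i≡k-j (pos-+*≡* y A x n eq)) (reorder (+ x) (+ n) (+ y) (+ A))
  where
  reorder : ∀ x n y A → x * n - y * A ≡ - y * A + x * n
  reorder = solve-∀
... | Bézout.-+ x y eq =
  + y , - + x , trans (i+j≡k⇒i≡k-j (pos-+*≡* x n y A eq)) (reorder (+ y) (+ A) (+ x) (+ n))
  where
  reorder : ∀ y A x n → y * A - x * n ≡ y * A + - x * n
  reorder = solve-∀

gcd-Bézout : ∀ n X → ∃₂ λ P W → + gcd n ∣ X ∣ ≡ P * X + W * + n
gcd-Bézout n X with gcd-Bézoutℕ n ∣ X ∣ | ℤ.+∣i∣≡i⊎+∣i∣≡-i X
... | P , W , e | inj₁ ∣X∣≡X  = P , W , trans e (cong (λ t → P * t + W * + n) ∣X∣≡X)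
... | P , W , e | inj₂ ∣X∣≡-X = - P , W , trans e (cong (_+ W * + n) (begin
  P * + ∣ X ∣ ≡⟨ cong (P *_) ∣X∣≡-X ⟩
  P * - X     ≡⟨ ℤ.neg-distribʳ-* P X ⟨
  - (P * X)   ≡⟨ ℤ.neg-distribˡ-* P X ⟩
  - P * X     ∎))
  where open ≡-Reasoning

-- R = s * g where s is coprime to E and every prime factor of g divides E (phrased without
-- primes: whatever is coprime to E is coprime to g).
record CoprimeSplitting (E : ℤ) (R : ℕ) : Set where
  field
    s g : ℕ
    R≡s*g : R ≡ s ℕ.* g
    coprime-s : BézoutCoprime E (+ s)
    coprime-g : ∀ {X} → BézoutCoprime X E → BézoutCoprime X (+ g)

coprimeSplitting : ∀ E R → .{{NonZero R}} → CoprimeSplitting E R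
coprimeSplitting E = <-rec (λ R → .{{NonZero R}} → CoprimeSplitting E R) split
  where
  split : ∀ R → (∀ {q} → q ℕ.< R → .{{NonZero q}} → CoprimeSplitting E q) →
          .{{NonZero R}} → CoprimeSplitting E R
  split R rec with gcd R ∣ E ∣ | gcd[m,n]∣m R ∣ E ∣ | gcd[m,n]∣n R ∣ E ∣ | gcd-Bézout R E
  ... | 0 | ℕ.divides q R≡q*0 | _ | _ = ⊥-elim (ℕ.≢-nonZero⁻¹ R (trans R≡q*0 (ℕ.*-zeroʳ q)))
  ... | 1 | _ | _ | P , W , 1≡PE+WR = record
    { s = R ; g = 1 ; R≡s*g = sym (ℕ.*-identityʳ R)
    ; coprime-s = P , W , sym 1≡PE+WR
    ; coprime-g = λ _ → + 0 , + 1 , refl }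
  ... | g₀@(suc (suc _)) | g₀∣R@(ℕ.divides q R≡q*g₀) | g₀∣E | _ = record
    { s = s ; g = g ℕ.* g₀
    ; R≡s*g = trans R≡q*g₀ (trans (cong (ℕ._* g₀) R≡s*g) (ℕ.*-assoc s g g₀))
    ; coprime-s = coprime-s
    ; coprime-g = λ {X} X⊥E → subst (BézoutCoprime X) (sym (ℤ.pos-* g g₀))
        (BézoutCoprime-*ʳ (coprime-g X⊥E) (BézoutCoprime-∣ʳ X⊥E (∣ᵤ⇒∣ g₀∣E))) }
    where
    instance _ = ℕ.quotient≢0 g₀∣R
    open CoprimeSplitting (rec (ℕ.quotient-< g₀∣R))

shift-coprimeTo : ∀ {D E S x y} → x * E + y * S ≡ + 1 →
                  BézoutCoprime (D + x * (+ 1 - D) * E) S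
shift-coprimeTo {D} {E} {S} {x} {y} xE+yS≡1 = + 1 , (+ 1 - D) * y , (begin
  + 1 * (D + x * (+ 1 - D) * E) + (+ 1 - D) * y * S ≡⟨ solve (D ∷ x ∷ E ∷ y ∷ S ∷ []) ⟩
  D + (+ 1 - D) * (x * E + y * S)                   ≡⟨ cong (λ t → D + (+ 1 - D) * t) xE+yS≡1 ⟩
  D + (+ 1 - D) * + 1                               ≡⟨ solve (D ∷ []) ⟩
  + 1                                               ∎)
  where open ≡-Reasoning

-- With R = s * g as above and x E ≡ 1 (mod s), the shift j = x (1 − D) makes D + j E ≡ 1
-- (mod s), while D + j E stays coprime to E and hence to g.
coprime-shift : ∀ {D E} R → .{{NonZero R}} → BézoutCoprime D E →
                ∃[ j ] BézoutCoprime (D + j * E) (+ R)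
coprime-shift {D} {E} R D⊥E with coprimeSplitting E R
... | record { s = s ; g = g ; R≡s*g = R≡s*g
             ; coprime-s = x , y , xE+ys≡1 ; coprime-g = coprime-g } =
  j , subst (BézoutCoprime (D + j * E)) (sym (trans (cong +_ R≡s*g) (ℤ.pos-* s g)))
            (BézoutCoprime-*ʳ (shift-coprimeTo {D} {x = x} {y} xE+ys≡1)
                              (coprime-g (BézoutCoprime-+*ˡ j D⊥E)))
  where j = x * (+ 1 - D)

even-or-odd : ∀ m → ((+ 2) ∣ m) ⊎ ((+ 2) ∣ (m - + 1))
even-or-odd m with m /ℕ 2 | m %ℕ 2 | n%ℕd<d m 2 | a≡a%ℕn+[a/ℕn]*n m 2
... | q | 0 | _ | m≡0+q*2 = inj₁ (divides q (trans m≡0+q*2 (ℤ.+-identityˡ (q * + 2))))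
... | q | 1 | _ | m≡1+q*2 = inj₂ (divides q (begin
  m - + 1             ≡⟨ cong (_- + 1) m≡1+q*2 ⟩
  + 1 + q * + 2 - + 1 ≡⟨ solve (q ∷ []) ⟩
  q * + 2             ∎))
  where open ≡-Reasoning
... | _ | suc (suc _) | ℕ.s≤s (ℕ.s≤s ()) | _

∣[m-1]*X : ∀ {M N m X} → M ℕ.∣ N → (+ M) ∣ (+ 2 * X) → Coprime ∣ m ∣ N →
           (+ M) ∣ ((m - + 1) * X)
∣[m-1]*X {M} {N} {m} {X} M∣N M∣2X m⊥N with even-or-odd m
... | inj₁ 2∣m = ∣n⇒∣m*n (m - + 1) (∣ᵤ⇒∣ (ℤ.coprime-divisor (+ M) (+ 2) X M⊥2 (∣⇒∣ᵤ M∣2X)))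
  where
  M⊥2 : Coprime M 2
  M⊥2 (i∣M , i∣2) = m⊥N (ℕ.∣-trans i∣2 (∣⇒∣ᵤ 2∣m) , ℕ.∣-trans i∣M M∣N)
... | inj₂ (divides Q m-1≡Q*2) =
  subst ((+ M) ∣_) (sym (trans (cong (_* X) m-1≡Q*2) (ℤ.*-assoc Q (+ 2) X))) (∣n⇒∣m*n Q M∣2X)

mat-≡ : ∀ {a₁ b₁ c₁ d₁ a₂ b₂ c₂ d₂} → a₁ ≡ a₂ → b₁ ≡ b₂ → c₁ ≡ c₂ → d₁ ≡ d₂ →
        mat a₁ b₁ c₁ d₁ ≡ mat a₂ b₂ c₂ d₂
mat-≡ refl refl refl refl = refl

det-· : ∀ x y → det (x · y) ≡ det x * det y
det-· (mat a₁ b₁ c₁ d₁) (mat a₂ b₂ c₂ d₂) = binet a₁ b₁ c₁ d₁ a₂ b₂ c₂ d₂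
  where
  binet : ∀ a₁ b₁ c₁ d₁ a₂ b₂ c₂ d₂ →
    (a₁ * a₂ + b₁ * c₂) * (c₁ * b₂ + d₁ * d₂) - (a₁ * b₂ + b₁ * d₂) * (c₁ * a₂ + d₁ * c₂)
    ≡ (a₁ * d₁ - b₁ * c₁) * (a₂ * d₂ - b₂ * c₂)
  binet = solve-∀

IsSL-· : ∀ {x y} → IsSL x → IsSL y → IsSL (x · y)
IsSL-· {x} {y} detx≡1 dety≡1 = trans (det-· x y) (cong₂ _*_ detx≡1 dety≡1)

IsSL-inv : ∀ {x} → IsSL x → IsSL (inv x)
IsSL-inv {mat a b c d} detx≡1 = trans (det-adj a b c d) detx≡1
  where
  det-adj : ∀ a b c d → d * a - (- b) * (- c) ≡ a * d - b * c
  det-adj = solve-∀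

·-inv-cancel : ∀ y {h} → IsSL h → (y · inv h) · h ≡ y
·-inv-cancel (mat A B C D) {mat p q r s} deth≡1 =
  mat-≡ (scaled A B) (scaled′ A B) (scaled C D) (scaled′ C D)
  where
  open ≡-Reasoning
  scaled : ∀ X Y → (X * s + Y * - r) * p + (X * - q + Y * p) * r ≡ X
  scaled X Y = begin
    (X * s + Y * - r) * p + (X * - q + Y * p) * r ≡⟨ solve (X ∷ Y ∷ p ∷ q ∷ r ∷ s ∷ []) ⟩
    X * (p * s - q * r)                           ≡⟨ cong (X *_) deth≡1 ⟩
    X * + 1                                       ≡⟨ ℤ.*-identityʳ X ⟩
    X                                             ∎
  scaled′ : ∀ X Y → (X * s + Y * - r) * q + (X * - q + Y * p) * s ≡ Y
  scaled′ X Y = begin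
    (X * s + Y * - r) * q + (X * - q + Y * p) * s ≡⟨ solve (X ∷ Y ∷ p ∷ q ∷ r ∷ s ∷ []) ⟩
    Y * (p * s - q * r)                           ≡⟨ cong (Y *_) deth≡1 ⟩
    Y * + 1                                       ≡⟨ ℤ.*-identityʳ Y ⟩
    Y                                             ∎

IsSL⇒BézoutCoprime : ∀ {x} → IsSL x → BézoutCoprime (d x) (c x)
IsSL⇒BézoutCoprime {mat a b c d} detx≡1 =
  a , - b , trans (cong (_+_ (a * d)) (sym (ℤ.neg-distribˡ-* b c))) detx≡1

U : ℤ → Mat
U j = mat (+ 1) j (+ 0) (+ 1)

L : ℤ → Mat
L t = mat (+ 1) (+ 0) t (+ 1)

IsSL-U : ∀ j → IsSL (U j)
IsSL-U j = cong (λ t → + 1 - t) (ℤ.*-zeroʳ j)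

IsSL-·U : ∀ {h} j → IsSL h → IsSL (h · U j)
IsSL-·U {h} j slh = IsSL-· {h} {U j} slh (IsSL-U j)

U∈Γ₀ : ∀ N j → Γ₀ N (U j)
U∈Γ₀ N j = IsSL-U j , N ℕ.∣0

L∈Γ₀ : ∀ {N t} → (+ N) ∣ t → Γ₀ N (L t)
L∈Γ₀ N∣t = refl , ∣⇒∣ᵤ N∣t

L-+ : ∀ s t → L s · L t ≡ L (s + t)
L-+ s t =
  mat-≡ refl refl (cong₂ _+_ (ℤ.*-identityʳ s) (ℤ.*-identityˡ t)) (cong (_+ + 1) (ℤ.*-zeroʳ s))

c-·-inv : ∀ y h → c (y · inv h) ≡ c y * d h - d y * c h
c-·-inv (mat _ _ C D) (mat _ _ r s) = cong (_+_ (C * s)) (sym (ℤ.neg-distribʳ-* D r))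

c-·U : ∀ h j → c (h · U j) ≡ c h
c-·U (mat _ _ r s) j = trans (cong₂ _+_ (ℤ.*-identityʳ r) (ℤ.*-zeroʳ s)) (ℤ.+-identityʳ r)

d-·U : ∀ h j → d (h · U j) ≡ d h + j * c h
d-·U (mat _ _ r s) j = trans (cong₂ _+_ (ℤ.*-comm r j) (ℤ.*-identityʳ s)) (ℤ.+-comm (j * r) s)

module _ {N : ℕ} {S : Mat → Set} (Γ₀⊆S : ∀ {x} → Γ₀ N x → S x) where

  ∈-coset : ∀ {h y} → ⟨ S ⟩ h → IsSL h → IsSL y → (+ N) ∣ (c y * d h - d y * c h) → ⟨ S ⟩ y
  ∈-coset {h} {y} h∈ slh sly N∣cy*dh-dy*ch =
    subst ⟨ S ⟩ (·-inv-cancel y slh) (mul {x = y · inv h} (gen (Γ₀⊆S y·h⁻¹∈Γ₀)) h∈)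
    where
    y·h⁻¹∈Γ₀ : Γ₀ N (y · inv h)
    y·h⁻¹∈Γ₀ = IsSL-· {y} {inv h} sly (IsSL-inv {h} slh) ,
               ∣⇒∣ᵤ (subst ((+ N) ∣_) (sym (c-·-inv y h)) N∣cy*dh-dy*ch)

  ·U∈ : ∀ {h} j → ⟨ S ⟩ h → ⟨ S ⟩ (h · U j)
  ·U∈ j h∈ = mul h∈ (gen (Γ₀⊆S (U∈Γ₀ N j)))

  L-ℕ*∈ : ∀ {s} → ⟨ S ⟩ (L s) → ∀ n → ⟨ S ⟩ (L (+ n * s))
  L-ℕ*∈ Ls∈ zero = one
  L-ℕ*∈ {s} Ls∈ (suc n) =
    subst ⟨ S ⟩ (trans (L-+ s (+ n * s)) (cong L (sym (ℤ.suc-* (+ n) s)))) (mul Ls∈ (L-ℕ*∈ Ls∈ n))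

  L-*∈ : ∀ {s} → ⟨ S ⟩ (L s) → ∀ j → ⟨ S ⟩ (L (j * s))
  L-*∈ Ls∈ (+ n) = L-ℕ*∈ Ls∈ n
  L-*∈ {s} Ls∈ -[1+ n ] = subst ⟨ S ⟩ (cong L (ℤ.neg-distribˡ-* (+ suc n) s))
    (ginv {x = L (+ suc n * s)} (L-ℕ*∈ Ls∈ (suc n)))

  L-lin∈ : ∀ {s} → ⟨ S ⟩ (L s) → ∀ i j → ⟨ S ⟩ (L (i * s + j * + N))
  L-lin∈ {s} Ls∈ i j = subst ⟨ S ⟩ (L-+ (i * s) (j * + N))
    (mul {y = L (j * + N)} (L-*∈ Ls∈ i) (gen (Γ₀⊆S (L∈Γ₀ (∣n⇒∣m*n j ∣-refl)))))

  module _ .{{_ : NonZero N}} where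

    L-span∈ : ∀ {h} → ⟨ S ⟩ h → IsSL h → ∀ P W → ⟨ S ⟩ (L (P * c h + W * + N))
    L-span∈ {h} h∈ slh P W = go (coprime-shift N (IsSL⇒BézoutCoprime {h} slh))
      where
      unit-multiple-congruent : ∀ x u f v n → u * f + v * n ≡ + 1 →
                                x * u * f - + 1 * x ≡ - (x * v) * n
      unit-multiple-congruent x u f v n uf+vn≡1 = begin
        x * u * f - + 1 * x                   ≡⟨ solve (x ∷ u ∷ f ∷ v ∷ n ∷ []) ⟩
        x * (u * f + v * n - + 1) - x * v * n ≡⟨ cong (λ t → x * (t - + 1) - x * v * n) uf+vn≡1 ⟩
        x * (+ 1 - + 1) - x * v * n           ≡⟨ solve (x ∷ v ∷ n ∷ []) ⟩
        - (x * v) * n                         ∎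
        where open ≡-Reasoning
      span-of-unit-multiple : ∀ x f u v P W n → u * f + v * n ≡ + 1 →
                              P * f * (x * u) + (W + P * x * v) * n ≡ P * x + W * n
      span-of-unit-multiple x f u v P W n uf+vn≡1 = begin
        P * f * (x * u) + (W + P * x * v) * n ≡⟨ solve (x ∷ f ∷ u ∷ v ∷ P ∷ W ∷ n ∷ []) ⟩
        P * x * (u * f + v * n) + W * n       ≡⟨ cong (λ t → P * x * t + W * n) uf+vn≡1 ⟩
        P * x * + 1 + W * n                   ≡⟨ cong (_+ W * n) (ℤ.*-identityʳ (P * x)) ⟩
        P * x + W * n                         ∎
        where open ≡-Reasoning
      go : ∃[ β ] BézoutCoprime (d h + β * c h) (+ N) → ⟨ S ⟩ (L (P * c h + W * + N))
      go (β , u , v , uf+vN≡1) =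
        subst (λ t → ⟨ S ⟩ (L t)) (span-of-unit-multiple (c h) f u v P W (+ N) uf+vN≡1)
          (L-lin∈ Lcu∈ (P * f) (W + P * c h * v))
        where
        f = d h + β * c h
        Lcu∈ : ⟨ S ⟩ (L (c h * u))
        Lcu∈ = ∈-coset (·U∈ β h∈) (IsSL-·U {h} β slh) refl (divides (- (c h * v)) (begin
          c h * u * d (h · U β) - + 1 * c (h · U β)
            ≡⟨ cong₂ (λ s t → c h * u * s - + 1 * t) (d-·U h β) (c-·U h β) ⟩
          c h * u * f - + 1 * c h
            ≡⟨ unit-multiple-congruent (c h) u f v (+ N) uf+vN≡1 ⟩
          - (c h * v) * + N ∎))
          where open ≡-Reasoning

    L-∣∈ : ∀ {h} → ⟨ S ⟩ h → IsSL h → ∀ {t} → (+ gcd N ∣ c h ∣) ∣ t → ⟨ S ⟩ (L t)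
    L-∣∈ {h} h∈ slh {t} (divides k t≡k*M) with gcd-Bézout N (c h)
    ... | P , W , M≡Pc+WN =
      subst (λ t → ⟨ S ⟩ (L t)) (sym t≡kP*c+kW*N) (L-span∈ h∈ slh (k * P) (k * W))
      where
      open ≡-Reasoning
      t≡kP*c+kW*N : t ≡ k * P * c h + k * W * + N
      t≡kP*c+kW*N = begin
        t                             ≡⟨ t≡k*M ⟩
        k * + gcd N ∣ c h ∣           ≡⟨ cong (k *_) M≡Pc+WN ⟩
        k * (P * c h + W * + N)       ≡⟨ ℤ.*-distribˡ-+ k (P * c h) (W * + N) ⟩
        k * (P * c h) + k * (W * + N) ≡⟨ cong₂ _+_ (ℤ.*-assoc k P (c h)) (ℤ.*-assoc k W (+ N)) ⟨
        k * P * c h + k * W * + N     ∎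

    Γ₀[gcd]⊆⟨⟩ : ∀ {h y} → ⟨ S ⟩ h → IsSL h → Γ₀ (gcd N ∣ c h ∣) y → ⟨ S ⟩ y
    Γ₀[gcd]⊆⟨⟩ {h} {y} h∈ slh (sly , M∣cy) = go (coprime-shift N (IsSL⇒BézoutCoprime {y} sly))
      where
      shifted-unit-congruent : ∀ x y j u v n → u * (y + j * x) + v * n ≡ + 1 →
                         x * (+ 1 + - j * (x * u)) - y * (x * u) ≡ x * v * n
      shifted-unit-congruent x y j u v n uf+vn≡1 = begin
        x * (+ 1 + - j * (x * u)) - y * (x * u)
          ≡⟨ solve (x ∷ y ∷ j ∷ u ∷ v ∷ n ∷ []) ⟩
        x * (+ 1 - (u * (y + j * x) + v * n)) + x * v * n
          ≡⟨ cong (λ t → x * (+ 1 - t) + x * v * n) uf+vn≡1 ⟩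
        x * (+ 1 - + 1) + x * v * n
          ≡⟨ solve (x ∷ v ∷ n ∷ []) ⟩
        x * v * n ∎
        where open ≡-Reasoning
      go : ∃[ j ] BézoutCoprime (d y + j * c y) (+ N) → ⟨ S ⟩ y
      go (j , u , v , uf+vN≡1) =
        ∈-coset (·U∈ (- j) Lt∈) (IsSL-·U {L t} (- j) refl) sly (divides (c y * v) (begin
          c y * d (L t · U (- j)) - d y * c (L t · U (- j))
            ≡⟨ cong₂ (λ s r → c y * s - d y * r) (d-·U (L t) (- j)) (c-·U (L t) (- j)) ⟩
          c y * (+ 1 + - j * (c y * u)) - d y * (c y * u)
            ≡⟨ shifted-unit-congruent (c y) (d y) j u v (+ N) uf+vN≡1 ⟩
          c y * v * + N ∎))
        where
        open ≡-Reasoning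
        t = c y * u
        Lt∈ : ⟨ S ⟩ (L t)
        Lt∈ = L-∣∈ h∈ slh (∣m⇒∣m*n {m = c y} u (∣ᵤ⇒∣ M∣cy))

Γ₀-· : ∀ {k x y} → Γ₀ k x → Γ₀ k y → Γ₀ k (x · y)
Γ₀-· {k} {x} {y} (slx , k∣cx) (sly , k∣cy) =
  IsSL-· {x} {y} slx sly ,
  ∣⇒∣ᵤ {+ k} (∣m∣n⇒∣m+n (∣m⇒∣m*n {m = c x} (a y) (∣ᵤ⇒∣ k∣cx)) (∣n⇒∣m*n (d x) {c y} (∣ᵤ⇒∣ k∣cy)))

Γ₀-inv : ∀ {k x} → Γ₀ k x → Γ₀ k (inv x)
Γ₀-inv {k} {x} (slx , k∣cx) = IsSL-inv {x} slx , subst (k ℕ.∣_) (sym (ℤ.∣-i∣≡∣i∣ (c x))) k∣cx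

⟨⟩⊆Γ₀ : ∀ {k S} → (∀ {x} → S x → Γ₀ k x) → ∀ {x} → ⟨ S ⟩ x → Γ₀ k x
⟨⟩⊆Γ₀ S⊆Γ₀ (gen x∈S)  = S⊆Γ₀ x∈S
⟨⟩⊆Γ₀ {k} S⊆Γ₀ one    = refl , k ℕ.∣0
⟨⟩⊆Γ₀ S⊆Γ₀ (mul {x} {y} x∈ y∈) = Γ₀-· {x = x} {y} (⟨⟩⊆Γ₀ S⊆Γ₀ x∈) (⟨⟩⊆Γ₀ S⊆Γ₀ y∈)
⟨⟩⊆Γ₀ S⊆Γ₀ (ginv {x} x∈) = Γ₀-inv {x = x} (⟨⟩⊆Γ₀ S⊆Γ₀ x∈)

Γ₀-∣ : ∀ {k n x} → k ℕ.∣ n → Γ₀ n x → Γ₀ k x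
Γ₀-∣ k∣n (slx , n∣cx) = slx , ℕ.∣-trans k∣n n∣cx

T⊆Γ₀[level] : ∀ {N γ x} → IsSL γ → T N γ x → Γ₀ (level N γ) x
T⊆Γ₀[level] {N} {γ@(mat p q r s)} slγ
            (γ′@(mat p′ q′ r′ s′) , slγ′ , s′≡s , (m , m⊥N , r′≡mr) , refl) =
  IsSL-· {γ′} {inv γ} slγ′ (IsSL-inv {γ} slγ) ,
  ∣⇒∣ᵤ (subst ((+ M) ∣_) (sym decomposition)
    (∣m∣n⇒∣m+n (∣m∣n⇒∣m-n (∣m⇒∣m*n {m = r′ - m * r} s (M∣N[mod] {r′} {m * r} r′≡mr))
                          (∣m⇒∣m*n {m = s′ - s} r (M∣N[mod] {s′} {s} s′≡s)))
               (∣[m-1]*X {m = m} M∣N M∣2rs m⊥N)))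
  where
  M = level N γ
  M∣N : M ℕ.∣ N
  M∣N = gcd[m,n]∣m N ∣ + 2 * r * s ∣
  M∣N[mod] : ∀ {x y} → x ≡ y [mod N ] → (+ M) ∣ (x - y)
  M∣N[mod] {x} {y} N∣x-y = ∣ᵤ⇒∣ {i = x - y} (ℕ.∣-trans M∣N N∣x-y)
  M∣2rs : (+ M) ∣ (+ 2 * (r * s))
  M∣2rs = subst ((+ M) ∣_) (ℤ.*-assoc (+ 2) r s) (∣ᵤ⇒∣ (gcd[m,n]∣n N ∣ + 2 * r * s ∣))
  decomposition : r′ * s + s′ * - r ≡ (r′ - m * r) * s - (s′ - s) * r + (m - + 1) * (r * s)
  decomposition = solve (r′ ∷ s′ ∷ r ∷ s ∷ m ∷ [])

Gens⊆Γ₀[level] : ∀ {N γ x} → IsSL γ → Gens N γ x → Γ₀ (level N γ) x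
Gens⊆Γ₀[level] {N} {γ} {x} _ (inj₁ x∈Γ₀N) = Γ₀-∣ {x = x} (gcd[m,n]∣m N ∣ + 2 * c γ * d γ ∣) x∈Γ₀N
Gens⊆Γ₀[level] slγ (inj₂ x∈T) = T⊆Γ₀[level] slγ x∈T

≡⇒≡[mod] : ∀ {x y} N → x ≡ y → x ≡ y [mod N ]
≡⇒≡[mod] {x} N refl = subst (N ℕ.∣_) (cong ∣_∣ (sym (ℤ.+-inverseʳ x))) (N ℕ.∣0)

reflect : Mat → Mat
reflect (mat p q r s) = mat p (- q) (- r) s

IsSL-reflect : ∀ {γ} → IsSL γ → IsSL (reflect γ)
IsSL-reflect {mat p q r s} slγ = trans (det-reflect p q r s) slγ
  where
  det-reflect : ∀ p q r s → p * s - (- q) * (- r) ≡ p * s - q * r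
  det-reflect = solve-∀

reflect·inv∈T : ∀ N γ → IsSL γ → T N γ (reflect γ · inv γ)
reflect·inv∈T N γ@(mat _ _ r s) slγ =
  reflect γ , IsSL-reflect {γ} slγ ,
  ≡⇒≡[mod] {s} N refl , (-1ℤ , 1-coprimeTo N , ≡⇒≡[mod] N (sym (ℤ.-1*i≡-i r))) , refl

gcd[N,c[reflect·inv]]≡level : ∀ N γ → gcd N ∣ c (reflect γ · inv γ) ∣ ≡ level N γ
gcd[N,c[reflect·inv]]≡level N (mat p q r s) =
  cong (gcd N) (trans (cong ∣_∣ (c≡-2rs r s)) (ℤ.∣-i∣≡∣i∣ (+ 2 * r * s)))
  where
  c≡-2rs : ∀ r s → - r * s + s * - r ≡ - (+ 2 * r * s)
  c≡-2rs = solve-∀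

proposition20 : (N : ℕ) → 1 ≤ N → (γ : Mat) → IsSL γ →
    (x : Mat) → ⟨ Gens N γ ⟩ x ⇔ Γ₀ (level N γ) x
proposition20 N 1≤N γ slγ x = mk⇔
  (⟨⟩⊆Γ₀ (Gens⊆Γ₀[level] slγ))
  (Γ₀[gcd]⊆⟨⟩ inj₁ {y = x} (gen (inj₂ (reflect·inv∈T N γ slγ))) slx₀
    ∘ subst (λ k → Γ₀ k x) (sym (gcd[N,c[reflect·inv]]≡level N γ)))
  where
  instance _ = ℕ.>-nonZero 1≤N
  slx₀ : IsSL (reflect γ · inv γ)
  slx₀ = IsSL-· {reflect γ} {inv γ} (IsSL-reflect {γ} slγ) (IsSL-inv {γ} slγ)
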